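{- For positive integers $n$ and $k$, $\operatorname{aw}(\mathbb{Z}_n,k)=n$ if and only if $k=n$.
   Context: $\mathbb{Z}_n$ is the cyclic group of integers mod $n$. A $k$-AP in $\mathbb{Z}_n$ is a set of $k$ distinct elements $a,a+d,\dots,a+(k-1)d$ (mod $n$), $d\not\equiv 0$. An $r$-coloring is a map $\mathbb{Z}_n\to\{1,\dots,r\}$, exact if surjective; a $k$-AP is rainbow if its elements receive $k$ distinct colors. $\operatorname{aw}(\mathbb{Z}_n,k)$ is the smallest $r$ such that every exact $r$-coloring of $\mathbb{Z}_n$ contains a rainbow $k$-AP; by convention it equals $n+1$ if $n<k$. -}

module Defs where

open import Data.Nat using (ℕ; zero; suc; _+_; _*_; _<_; _≤_; NonZero)
open import Data.Nat.DivMod using (_mod_)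
open import Data.Fin using (Fin)
open import Data.Product using (Σ; _×_; ∃; ∃-syntax)
open import Relation.Binary.PropositionalEquality using (_≡_; _≢_)

term : (n : ℕ) .{{_ : NonZero n}} → ℕ → ℕ → ℕ → Fin n
term n a d i = (a + i * d) mod n

Coloring : ℕ → ℕ → Set
Coloring n r = Fin n → Fin r

Exact : {n r : ℕ} → Coloring n r → Set
Exact {n} {r} c = ∀ (j : Fin r) → ∃[ x ] c x ≡ j

-- c contains a rainbow k-AP: there are a, d such that the k terms
-- a, a+d, …, a+(k-1)d are pairwise distinct in ℤ_n (so they form a k-AP;
-- for k ≥ 2 this forces d ≢ 0 mod n) and receive pairwise distinct colors.
HasRainbowAP : (n : ℕ) .{{_ : NonZero n}} {r : ℕ} → ℕ → Coloring n r → Set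
HasRainbowAP n k c =
  Σ ℕ λ a → Σ ℕ λ d →
    (∀ i j → i < k → j < k → i ≢ j → term n a d i ≢ term n a d j)
    × (∀ i j → i < k → j < k → i ≢ j → c (term n a d i) ≢ c (term n a d j))

Forces : (n : ℕ) .{{_ : NonZero n}} → ℕ → ℕ → Set
Forces n k r = (c : Coloring n r) → Exact c → HasRainbowAP n k c

-- IsAW n k m : m = aw(ℤ_n, k), i.e. m is the smallest positive r such that
-- every exact r-coloring of ℤ_n contains a rainbow k-AP; by convention
-- aw(ℤ_n, k) = n + 1 when n < k.
IsAW : (n : ℕ) .{{_ : NonZero n}} → ℕ → ℕ → Set
IsAW n k m =
  (n < k → m ≡ suc n)
  × (k ≤ n → (1 ≤ m × Forces n k m × (∀ r → 1 ≤ r → Forces n k r → m ≤ r)))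

module Submission where

-- Three facts about exact colorings of ℤ_n = Fin n drive the proof.
--  * Lower bound: a rainbow k-AP needs k distinct colors, and an exact
--    r-coloring of ℤ_n exists whenever 1 ≤ r ≤ n; so if every exact
--    r-coloring (1 ≤ r ≤ n) has a rainbow k-AP, then k ≤ r.
--  * Upper bounds via consecutive progressions a, a+1, …, a+k-1 (k ≤ n),
--    whose terms are distinct in ℤ_n:
--      - an exact n-coloring of ℤ_n is injective, so every such progression
--        is rainbow: n colors force a rainbow k-AP for all k ≤ n;
--      - an exact n-coloring of ℤ_{n+1} is injective away from one point y,
--        so the progression y+1, …, y+k (which avoids y) is rainbow:
--        n colors force a rainbow k-AP in ℤ_{n+1} for all k ≤ n.
-- For k = n the bounds give aw = n; for 1 ≤ k < n the second upper bound
-- gives aw ≤ n - 1, and for k > n the convention gives aw = n + 1.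

open import Defs
open import Data.Nat using (ℕ; suc; _+_; _*_; _≤_; _<_; NonZero; z≤n; s≤s; s≤s⁻¹)
open import Data.Nat.Properties
  using (≤-refl; ≤-trans; ≤-antisym; <⇒≤; <-≤-trans; <-irrefl; 1+n≢n; <-cmp; m≤n⇒m≤1+n; *-identityʳ; +-suc)
open import Data.Nat.DivMod using (_%_; _mod_; %-distribˡ-+; [m+kn]%n≡m%n; [m+n]%n≡m%n; m<n⇒m%n≡m)
open import Data.Nat.Tactic.RingSolver using (solve-∀)
open import Data.Fin as Fin using (Fin; toℕ; inject≤; punchIn; punchOut)
open import Data.Fin.Properties
  using (toℕ-injective; toℕ<n; toℕ-fromℕ<; toℕ-inject≤; pigeonhole; injective⇒≤;
         punchIn-punchOut)
open import Data.Product using (Σ; _×_; _,_; proj₁; proj₂; ∃-syntax)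
open import Data.Empty using (⊥-elim)
open import Relation.Nullary using (yes; no)
open import Relation.Binary.PropositionalEquality
  using (_≡_; _≢_; refl; sym; trans; cong; subst; module ≡-Reasoning)
open import Relation.Binary.Definitions using (tri<; tri≈; tri>)

-- Translation x ↦ a + x is injective modulo N: adding a·(N-1) turns a + x
-- into x + a·N, undoing the translation.
+-cancelˡ-% : ∀ {N} .{{_ : NonZero N}} a i j → (a + i) % N ≡ (a + j) % N → i % N ≡ j % N
+-cancelˡ-% {suc p} a i j eq = begin
  i % N                                  ≡⟨ sym (unshift i) ⟩
  (a * p + (a + i)) % N                  ≡⟨ %-distribˡ-+ (a * p) (a + i) N ⟩
  ((a * p) % N + (a + i) % N) % N        ≡⟨ cong (λ t → ((a * p) % N + t) % N) eq ⟩
  ((a * p) % N + (a + j) % N) % N        ≡⟨ sym (%-distribˡ-+ (a * p) (a + j) N) ⟩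
  (a * p + (a + j)) % N                  ≡⟨ unshift j ⟩
  j % N                                  ∎
  where
  open ≡-Reasoning
  N : ℕ
  N = suc p
  regroup : ∀ b q x → b * q + (b + x) ≡ x + b * suc q
  regroup = solve-∀
  unshift : ∀ x → (a * p + (a + x)) % N ≡ x % N
  unshift x = trans (cong (_% N) (regroup a p x)) ([m+kn]%n≡m%n x a N)

toℕ-step1 : ∀ N .{{_ : NonZero N}} a i → toℕ (term N a 1 i) ≡ (a + i) % N
toℕ-step1 N a i = trans (toℕ-fromℕ< _) (cong (λ t → (a + t) % N) (*-identityʳ i))

step1-injective : ∀ N .{{_ : NonZero N}} a {i j} → i < N → j < N → term N a 1 i ≡ term N a 1 j → i ≡ j
step1-injective N a {i} {j} i<N j<N eq = begin
  i      ≡⟨ sym (m<n⇒m%n≡m i<N) ⟩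
  i % N  ≡⟨ +-cancelˡ-% a i j (trans (sym (toℕ-step1 N a i)) (trans (cong toℕ eq) (toℕ-step1 N a j))) ⟩
  j % N  ≡⟨ m<n⇒m%n≡m j<N ⟩
  j      ∎
  where open ≡-Reasoning

step1-rainbow : ∀ N .{{_ : NonZero N}} {r k} (c : Coloring N r) a → k ≤ N
  → (∀ i j → i < k → j < k → c (term N a 1 i) ≡ c (term N a 1 j) → term N a 1 i ≡ term N a 1 j)
  → HasRainbowAP N k c
step1-rainbow N {k = k} c a k≤N c-inj = a , 1 , distinct , rainbow
  where
  distinct : ∀ i j → i < k → j < k → i ≢ j → term N a 1 i ≢ term N a 1 j
  distinct i j i<k j<k i≢j eq = i≢j (step1-injective N a (<-≤-trans i<k k≤N) (<-≤-trans j<k k≤N) eq)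
  rainbow : ∀ i j → i < k → j < k → i ≢ j → c (term N a 1 i) ≢ c (term N a 1 j)
  rainbow i j i<k j<k i≢j eq = distinct i j i<k j<k i≢j (c-inj i j i<k j<k eq)

-- Choosing a preimage of every color is injective, so an exact r-coloring
-- of ℤ_n has r ≤ n.
exact⇒≤ : ∀ {n r} (c : Coloring n r) → Exact c → r ≤ n
exact⇒≤ c exact = injective⇒≤ {f = λ j → proj₁ (exact j)} λ {j} {j'} eq →
  trans (sym (proj₂ (exact j))) (trans (cong c eq) (proj₂ (exact j')))

exact-delete : ∀ {m r} (c : Coloring (suc m) r) → Exact c → ∀ {x x'}
  → x ≢ x' → c x ≡ c x' → Exact (λ z → c (punchIn x z))
exact-delete c exact {x} {x'} x≢x' cx≡cx' j with exact j
... | z , cz≡j with x Fin.≟ z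
...   | no x≢z  = punchOut x≢z , trans (cong c (punchIn-punchOut x≢z)) cz≡j
...   | yes refl = punchOut x≢x' , trans (cong c (punchIn-punchOut x≢x')) (trans (sym cx≡cx') cz≡j)

-- An exact n-coloring of ℤ_n is injective: a repeated color could be
-- deleted, leaving an exact n-coloring of ℤ_{n-1}.
exact-square-injective : ∀ {n} (c : Coloring n n) → Exact c → ∀ {x x'} → c x ≡ c x' → x ≡ x'
exact-square-injective {suc m} c exact {x} {x'} eq with x Fin.≟ x'
... | yes x≡x' = x≡x'
... | no x≢x'  = ⊥-elim (<-irrefl refl (exact⇒≤ _ (exact-delete c exact x≢x' eq)))

-- An exact n-coloring of ℤ_{n+1} is injective away from one point y:
-- some color repeats (pigeonhole) at y and another point; deleting y leaves
-- an exact n-coloring of ℤ_n, which is injective.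
exact-injective-off-point : ∀ {n} (c : Coloring (suc n) n) → Exact c
  → ∃[ y ] (∀ {u v} → y ≢ u → y ≢ v → c u ≡ c v → u ≡ v)
exact-injective-off-point {n} c exact with pigeonhole ≤-refl c
... | y , y' , y<y' , cy≡cy' = y , injective-off-y
  where
  y≢y' : y ≢ y'
  y≢y' refl = <-irrefl refl y<y'
  c-y : Coloring n n
  c-y z = c (punchIn y z)
  injective-off-y : ∀ {u v} → y ≢ u → y ≢ v → c u ≡ c v → u ≡ v
  injective-off-y {u} {v} y≢u y≢v cu≡cv = begin
    u                         ≡⟨ sym (punchIn-punchOut y≢u) ⟩
    punchIn y (punchOut y≢u)  ≡⟨ cong (punchIn y) (exact-square-injective c-y (exact-delete c exact y≢y' cy≡cy') c-eq) ⟩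
    punchIn y (punchOut y≢v)  ≡⟨ punchIn-punchOut y≢v ⟩
    v                         ∎
    where
    open ≡-Reasoning
    c-eq : c-y (punchOut y≢u) ≡ c-y (punchOut y≢v)
    c-eq = trans (cong c (punchIn-punchOut y≢u)) (trans cu≡cv (cong c (sym (punchIn-punchOut y≢v))))

exact-coloring : ∀ {n r} → 1 ≤ r → r ≤ n → Σ (Coloring n r) Exact
exact-coloring {n} {suc r-1} _ r≤n = colour , exact
  where
  r : ℕ
  r = suc r-1
  colour : Coloring n r
  colour x = toℕ x mod r
  exact : Exact colour
  exact j = inject≤ j r≤n , toℕ-injective (begin
    toℕ (colour (inject≤ j r≤n))  ≡⟨ toℕ-fromℕ< _ ⟩
    toℕ (inject≤ j r≤n) % r       ≡⟨ cong (_% r) (toℕ-inject≤ j r≤n) ⟩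
    toℕ j % r                     ≡⟨ m<n⇒m%n≡m (toℕ<n j) ⟩
    toℕ j                         ∎)
    where open ≡-Reasoning

rainbow⇒≤ : ∀ n .{{_ : NonZero n}} {k r} (c : Coloring n r) → HasRainbowAP n k c → k ≤ r
rainbow⇒≤ n {k} c (a , d , _ , rainbow) = injective⇒≤ {f = colour-of} colour-of-injective
  where
  colour-of : Fin k → Fin _
  colour-of i = c (term n a d (toℕ i))
  colour-of-injective : ∀ {i j} → colour-of i ≡ colour-of j → i ≡ j
  colour-of-injective {i} {j} eq with i Fin.≟ j
  ... | yes i≡j = i≡j
  ... | no i≢j  = ⊥-elim (rainbow (toℕ i) (toℕ j) (toℕ<n i) (toℕ<n j) (λ eq' → i≢j (toℕ-injective eq')) eq)

forces⇒≤ : ∀ n .{{_ : NonZero n}} {k r} → 1 ≤ r → r ≤ n → Forces n k r → k ≤ r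
forces⇒≤ n 1≤r r≤n forces with exact-coloring 1≤r r≤n
... | c , exact = rainbow⇒≤ n c (forces c exact)

forces-full : ∀ n .{{_ : NonZero n}} {k} → k ≤ n → Forces n k n
forces-full n k≤n c exact = step1-rainbow n c 0 k≤n λ _ _ _ _ → exact-square-injective c exact

-- Upper bound: n colors force a rainbow k-AP in ℤ_{n+1} for every k ≤ n,
-- using the progression y+1, …, y+k that avoids the exceptional point y.
forces-one-less : ∀ n {k} → k ≤ n → Forces (suc n) k n
forces-one-less n {k} k≤n c exact with exact-injective-off-point c exact
... | y , injective-off-y = step1-rainbow N c a (m≤n⇒m≤1+n k≤n) λ i j i<k j<k →
        injective-off-y (avoids-y i<k) (avoids-y j<k)
  where
  N : ℕ
  N = suc n
  a : ℕ
  a = suc (toℕ y)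
  last-is-y : term N a 1 n ≡ y
  last-is-y = toℕ-injective (begin
    toℕ (term N a 1 n)  ≡⟨ toℕ-step1 N a n ⟩
    (a + n) % N         ≡⟨ cong (_% N) (sym (+-suc (toℕ y) n)) ⟩
    (toℕ y + N) % N     ≡⟨ [m+n]%n≡m%n (toℕ y) N ⟩
    toℕ y % N           ≡⟨ m<n⇒m%n≡m (toℕ<n y) ⟩
    toℕ y               ∎)
    where open ≡-Reasoning
  avoids-y : ∀ {i} → i < k → y ≢ term N a 1 i
  avoids-y {i} i<k y≡term = <-irrefl (sym n≡i) (<-≤-trans i<k k≤n)
    where
    n≡i : n ≡ i
    n≡i = step1-injective N a ≤-refl (<-≤-trans i<k (m≤n⇒m≤1+n k≤n))
            (trans last-is-y y≡term)

proposition3p22 : (n k : ℕ) .{{_ : NonZero n}} → 1 ≤ k → (m : ℕ) → IsAW n k m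
                    → ((m ≡ n → k ≡ n) × (k ≡ n → m ≡ n))
proposition3p22 (suc n) k 1≤k m (if-n<k , if-k≤n) with <-cmp (suc n) k
-- For k > n + 1 the convention aw = n + 2 rules out both m ≡ n + 1 and k ≡ n + 1.
... | tri< N<k _ _ = (λ m≡N → ⊥-elim (1+n≢n (trans (sym (if-n<k N<k)) m≡N)))
                   , (λ k≡N → ⊥-elim (<-irrefl (sym k≡N) N<k))
... | tri≈ _ N≡k _ = (λ _ → sym N≡k) , λ _ → ≤-antisym m≤N N≤m
  where
  N : ℕ
  N = suc n
  k≤N : k ≤ N
  k≤N = subst (_≤ N) N≡k ≤-refl
  m≤N : m ≤ N
  m≤N = proj₂ (proj₂ (if-k≤n k≤N)) N (s≤s z≤n) (forces-full N k≤N)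
  N≤m : N ≤ m
  N≤m = subst (_≤ m) (sym N≡k) (forces⇒≤ N (proj₁ (if-k≤n k≤N)) m≤N (proj₁ (proj₂ (if-k≤n k≤N))))
-- For 1 ≤ k ≤ n, n colors already force a rainbow k-AP, so m ≤ n < n + 1.
... | tri> _ N≢k k<N = (λ m≡N → ⊥-elim (<-irrefl refl (subst (_≤ n) m≡N m≤n))) , (λ k≡N → ⊥-elim (N≢k (sym k≡N)))
  where
  k≤n : k ≤ n
  k≤n = s≤s⁻¹ k<N
  m≤n : m ≤ n
  m≤n = proj₂ (proj₂ (if-k≤n (<⇒≤ k<N))) n (≤-trans 1≤k k≤n) (forces-one-less n k≤n)
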